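{- Let $\mathcal{E}=(E_0,E_1,E_{\to})$ be a Fitch-satisfiable partial tuple on $V$ that is explained by the discriminating Fitch-cotree $(T,t)$, and for $W\subseteq V$ put $G_0[W]=(W,E_1[W]\cup E_{\to}[W])$. If there is an inner vertex $u$ of $T$ with $t(u)=0$, then $G_0[C]$ is edge-less for all $C\subseteq L(T(u))$.
   Context: $V$ is a finite nonempty set; all relations are irreflexive binary relations on $V$. Let $R^\times_V=\{(x,y): x,y\in V, x\neq y\}$, and $R[W]=\{(x,y)\in R: x,y\in W\}$. A partial tuple on $V$ is a triple $\mathcal{E}=(E_0,E_1,E_{\to})$ of relations on $V$ with $E_0,E_1$ symmetric, $E_{\to}$ antisymmetric, and $E_0\cup E_1\cup E_{\to}\subseteq R^\times_V$; it is full if the union equals $R^\times_V$. A tuple $(E_0',E_1',E_{\to}')$ extends $\mathcal{E}$ if $E_i\subseteq E_i'$ for each $i$. A rooted tree is a finite directed tree with edges directed away from its root, in which no non-root vertex has exactly one child; $L(T)$ is its leaf set, $V^0(T)$ its inner vertices, $w\prec_T v$ means $w$ is a proper descendant of $v$, $T(u)$ is the subtree rooted at $u$ (so $L(T(u))$ is the set of leaves below $u$), $\mathrm{lca}$ the least common ancestor. In an ordered rooted tree (children linearly ordered left to right), leaf $x$ is left of leaf $y$ if the child of $\mathrm{lca}(x,y)$ towards $x$ precedes the child towards $y$. A cotree on $V$ is an ordered rooted tree with leaf set $V$ and labeling $t\colon V^0(T)\to\{0,1,\vec1\}$; it explains the full tuple $(\{(x,y): t(\mathrm{lca}(x,y))=0\},\{(x,y):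 t(\mathrm{lca}(x,y))=1\},\{(x,y): t(\mathrm{lca}(x,y))=\vec1,\ x\text{ left of }y\})$ (pairs of distinct leaves), and it explains a partial tuple if this full tuple extends it. It is discriminating if $t(u)\neq t(v)$ for every tree edge $(u,v)$ with $u,v$ both inner. A Fitch-cotree is a cotree with no two inner vertices $v,w$, $w\prec_T v$, such that either (i) $t(v)=0\neq t(w)$, or (ii) $t(v)=\vec1$, $t(w)=1$, and $w\in V(T(u))$ for some child $u$ of $v$ other than the right-most child of $v$. A partial tuple is Fitch-satisfiable if some full tuple extending it is explained by a Fitch-cotree. -}

module Defs where

open import Level using (0ℓ)
open import Data.Nat using (ℕ; suc; _≤_; _<_)
open import Data.Fin using (Fin; toℕ)
open import Data.List using (List; []; _∷_; _++_; length; lookup)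
open import Data.List.Membership.Propositional using (_∈_)
open import Data.List.Relation.Unary.Unique.Propositional using (Unique)
open import Data.Product using (Σ; ∃; _×_; _,_)
open import Data.Sum using (_⊎_)
open import Relation.Nullary using (¬_)
open import Relation.Binary using (Rel; Symmetric; Antisymmetric)
open import Relation.Binary.PropositionalEquality using (_≡_; _≢_)
open import Relation.Unary using (Pred)

-- Vertex set V = Fin n (finite); nonemptiness is imposed in the statement.

record PartialTuple (n : ℕ) : Set₁ where
  field
    E₀ E₁ E→ : Rel (Fin n) 0ℓ
    sym₀     : Symmetric E₀
    sym₁     : Symmetric E₁
    antisym→ : Antisymmetric _≡_ E→
    irr₀     : ∀ {x y} → E₀ x y → x ≢ y
    irr₁     : ∀ {x y} → E₁ x y → x ≢ y
    irr→     : ∀ {x y} → E→ x y → x ≢ y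

open PartialTuple public

IsFull : ∀ {n} → PartialTuple n → Set
IsFull E = ∀ x y → x ≢ y → E₀ E x y ⊎ (E₁ E x y ⊎ E→ E x y)

Extends : ∀ {n} → PartialTuple n → PartialTuple n → Set
Extends F E = (∀ {x y} → E₀ E x y → E₀ F x y)
            × (∀ {x y} → E₁ E x y → E₁ F x y)
            × (∀ {x y} → E→ E x y → E→ F x y)

-- Labels and ordered labelled rooted trees (children lists are ordered
-- left to right).

data Lbl : Set where
  l0 l1 l→ : Lbl

data Tree (n : ℕ) : Set where
  leaf : Fin n → Tree n
  node : Lbl → List (Tree n) → Tree n

mutual
  leaves : ∀ {n} → Tree n → List (Fin n)
  leaves (leaf x)    = x ∷ []
  leaves (node l cs) = leavesL cs

  leavesL : ∀ {n} → List (Tree n) → List (Fin n)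
  leavesL []       = []
  leavesL (c ∷ cs) = leaves c ++ leavesL cs

-- u ⊑ T : u is (the subtree rooted at) a vertex of T
data _⊑_ {n : ℕ} : Tree n → Tree n → Set where
  here  : ∀ {t} → t ⊑ t
  there : ∀ {u c l cs} → u ⊑ c → c ∈ cs → u ⊑ node l cs

data _⊏_ {n : ℕ} : Tree n → Tree n → Set where
  below : ∀ {u c l cs} → u ⊑ c → c ∈ cs → u ⊏ node l cs

RootOK : ∀ {n} → Tree n → Set
RootOK (leaf x)    = Data.Unit.⊤
  where import Data.Unit
RootOK (node l cs) = 1 ≤ length cs

record IsCotree {n : ℕ} (T : Tree n) : Set where
  field
    rootOK    : RootOK T
    innerOK   : ∀ {l cs} → node l cs ⊏ T → 2 ≤ length cs
    leafUniq  : Unique (leaves T)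
    leafAll   : ∀ x → x ∈ leaves T

-- For distinct leaves x, y, the
-- lca of x and y is the unique vertex node l cs of T such that x and y lie
-- below distinct children cs[i], cs[j]; x is left of y iff i < j.

SplitAt : ∀ {n} → Tree n → Lbl → Fin n → Fin n → Set
SplitAt T l x y =
  Σ (List (Tree _)) λ cs → node l cs ⊑ T ×
  Σ (Fin (length cs)) λ i → Σ (Fin (length cs)) λ j →
    i ≢ j × x ∈ leaves (lookup cs i) × y ∈ leaves (lookup cs j)

LeftSplitAt : ∀ {n} → Tree n → Lbl → Fin n → Fin n → Set
LeftSplitAt T l x y =
  Σ (List (Tree _)) λ cs → node l cs ⊑ T ×
  Σ (Fin (length cs)) λ i → Σ (Fin (length cs)) λ j →
    toℕ i < toℕ j × x ∈ leaves (lookup cs i) × y ∈ leaves (lookup cs j)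

Explains : ∀ {n} → Tree n → PartialTuple n → Set
Explains T E = (∀ {x y} → E₀ E x y → SplitAt T l0 x y)
             × (∀ {x y} → E₁ E x y → SplitAt T l1 x y)
             × (∀ {x y} → E→ E x y → LeftSplitAt T l→ x y)

Discriminating : ∀ {n} → Tree n → Set
Discriminating T = ∀ {l cs l' ds} → node l cs ⊑ T →
  node l' ds ∈ cs → l ≢ l'

IsFitch : ∀ {n} → Tree n → Set
IsFitch T = ∀ {l cs l' ds} → node l cs ⊑ T → (i : Fin (length cs)) →
  node l' ds ⊑ lookup cs i →
    ¬ (l ≡ l0 × l' ≢ l0)
  × ¬ (l ≡ l→ × l' ≡ l1 × suc (toℕ i) < length cs)

FitchCotree : ∀ {n} → Tree n → Set
FitchCotree T = IsCotree T × IsFitch T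

FitchSatisfiable : ∀ {n} → PartialTuple n → Set₁
FitchSatisfiable E = Σ (PartialTuple _) λ F → IsFull F × Extends F E ×
  Σ (Tree _) λ T → FitchCotree T × Explains T F

G₀Edgeless : ∀ {n} → PartialTuple n → Pred (Fin n) 0ℓ → Set
G₀Edgeless E W = ∀ x y → W x → W y → ¬ (E₁ E x y ⊎ E→ E x y)

{-# OPTIONS --safe #-}
-- An E₁- or E→-edge xy is explained by an inner vertex v of T labelled 1 or →
-- that separates x and y into distinct children.  Since the leaves of T are
-- distinct, every vertex containing both x and y lies above v; for x, y
-- below u this puts v into T(u).  But by Fitch condition (i) every inner
-- vertex below a vertex labelled 0 is itself labelled 0.
module Submission where

open import Defs
open import Level using (0ℓ)
open import Data.Nat using (ℕ; suc)
open import Data.Nat.Properties using (<-irrefl)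
open import Data.Fin using (Fin; zero; suc; toℕ)
open import Data.List using (List; []; _∷_; _++_; length; lookup)
open import Data.List.Membership.Propositional using (_∈_)
open import Data.List.Membership.Propositional.Properties using (∈-++⁺ˡ; ∈-++⁺ʳ; ∈-lookup)
open import Data.List.Relation.Binary.Disjoint.Propositional using (Disjoint)
open import Data.List.Relation.Unary.All using () renaming (lookup to All-lookup)
open import Data.List.Relation.Unary.All.Properties using (++⁻ˡ)
open import Data.List.Relation.Unary.Any using (here; there; index)
open import Data.List.Relation.Unary.Any.Properties using (lookup-index)
open import Data.List.Relation.Unary.Unique.Propositional using (Unique; []; _∷_)
open import Data.Empty using (⊥-elim)
open import Data.Product using (_,_; proj₁)
open import Data.Sum using (_⊎_; inj₁; inj₂)
open import Relation.Nullary using (¬_)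
open import Relation.Unary using (Pred)
open import Relation.Binary.PropositionalEquality using (_≡_; _≢_; refl; cong; subst; module ≡-Reasoning)

module _ {A : Set} where

  Unique-++⁻ˡ : ∀ (xs : List A) {ys} → Unique (xs ++ ys) → Unique xs
  Unique-++⁻ˡ []       _          = []
  Unique-++⁻ˡ (x ∷ xs) (x∉ ∷ xs!) = ++⁻ˡ xs x∉ ∷ Unique-++⁻ˡ xs xs!

  Unique-++⁻ʳ : ∀ (xs : List A) {ys} → Unique (xs ++ ys) → Unique ys
  Unique-++⁻ʳ []       ys!       = ys!
  Unique-++⁻ʳ (x ∷ xs) (_ ∷ xs!) = Unique-++⁻ʳ xs xs!

  Unique-++⇒Disjoint : ∀ (xs : List A) {ys} → Unique (xs ++ ys) → Disjoint xs ys
  Unique-++⇒Disjoint (x ∷ xs) (x∉ ∷ _)   (here refl , v∈ys) = All-lookup x∉ (∈-++⁺ʳ xs v∈ys) refl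
  Unique-++⇒Disjoint (x ∷ xs) (_ ∷ xs!) (there v∈xs , v∈ys) = Unique-++⇒Disjoint xs xs! (v∈xs , v∈ys)

module _ {n : ℕ} where
  open ≡-Reasoning

  leaf-of-child : ∀ {c : Tree n} {cs x} → c ∈ cs → x ∈ leaves c → x ∈ leavesL cs
  leaf-of-child               (here refl) x∈c = ∈-++⁺ˡ x∈c
  leaf-of-child {cs = d ∷ cs} (there c∈)  x∈c = ∈-++⁺ʳ (leaves d) (leaf-of-child c∈ x∈c)

  leaf-of-⊑ : ∀ {u T : Tree n} {x} → u ⊑ T → x ∈ leaves u → x ∈ leaves T
  leaf-of-⊑ here           x∈u = x∈u
  leaf-of-⊑ (there u⊑c c∈) x∈u = leaf-of-child c∈ (leaf-of-⊑ u⊑c x∈u)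

  leaf-of-lookup-index : ∀ {c : Tree n} {cs x} (c∈ : c ∈ cs) →
    x ∈ leaves c → x ∈ leaves (lookup cs (index c∈))
  leaf-of-lookup-index {x = x} c∈ = subst (λ d → x ∈ leaves d) (lookup-index c∈)

  Unique-child : ∀ {c : Tree n} {cs} → Unique (leavesL cs) → c ∈ cs → Unique (leaves c)
  Unique-child {cs = c ∷ _} cs! (here refl) = Unique-++⁻ˡ (leaves c) cs!
  Unique-child {cs = d ∷ _} cs! (there c∈)  = Unique-child (Unique-++⁻ʳ (leaves d) cs!) c∈

  Unique-⊑ : ∀ {u T : Tree n} → Unique (leaves T) → u ⊑ T → Unique (leaves u)
  Unique-⊑ T! here           = T!
  Unique-⊑ T! (there u⊑c c∈) = Unique-⊑ (Unique-child T! c∈) u⊑c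

  leaf-determines-index : ∀ (cs : List (Tree n)) {x} {i j : Fin (length cs)} →
    Unique (leavesL cs) → x ∈ leaves (lookup cs i) → x ∈ leaves (lookup cs j) → i ≡ j
  leaf-determines-index (c ∷ cs) {i = zero}  {zero}  _   _   _   = refl
  leaf-determines-index (c ∷ cs) {i = zero}  {suc j} cs! x∈c x∈j =
    ⊥-elim (Unique-++⇒Disjoint (leaves c) cs! (x∈c , leaf-of-child (∈-lookup {xs = cs} j) x∈j))
  leaf-determines-index (c ∷ cs) {i = suc i} {zero}  cs! x∈i x∈c =
    ⊥-elim (Unique-++⇒Disjoint (leaves c) cs! (x∈c , leaf-of-child (∈-lookup {xs = cs} i) x∈i))
  leaf-determines-index (c ∷ cs) {i = suc i} {suc j} cs! x∈i x∈j =
    cong suc (leaf-determines-index cs (Unique-++⁻ʳ (leaves c) cs!) x∈i x∈j)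

  leaf-determines-child : ∀ {c c' : Tree n} {cs x} → Unique (leavesL cs) →
    c ∈ cs → c' ∈ cs → x ∈ leaves c → x ∈ leaves c' → c ≡ c'
  leaf-determines-child {cs = cs} cs! c∈ c'∈ x∈c x∈c' = begin
    _                     ≡⟨ lookup-index c∈ ⟩
    lookup cs (index c∈)  ≡⟨ cong (lookup cs) same-index ⟩
    lookup cs (index c'∈) ≡⟨ lookup-index c'∈ ⟨
    _                     ∎
    where
    same-index : index c∈ ≡ index c'∈
    same-index = leaf-determines-index cs cs!
      (leaf-of-lookup-index c∈ x∈c) (leaf-of-lookup-index c'∈ x∈c')

  ⊑-nested : ∀ {T u v : Tree n} {x} → Unique (leaves T) → u ⊑ T → v ⊑ T →
    x ∈ leaves u → x ∈ leaves v → v ⊑ u ⊎ u ⊏ v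
  ⊑-nested _  here           v⊑T            _   _   = inj₁ v⊑T
  ⊑-nested _  (there u⊑c c∈) here           _   _   = inj₂ (below u⊑c c∈)
  ⊑-nested T! (there u⊑c c∈) (there v⊑d d∈) x∈u x∈v
    with leaf-determines-child T! c∈ d∈ (leaf-of-⊑ u⊑c x∈u) (leaf-of-⊑ v⊑d x∈v)
  ... | refl = ⊑-nested (Unique-child T! c∈) u⊑c v⊑d x∈u x∈v

  separator-⊑ : ∀ {T u : Tree n} {l ds x y} {i j : Fin (length ds)} →
    Unique (leaves T) → u ⊑ T → node l ds ⊑ T → x ∈ leaves u → y ∈ leaves u →
    i ≢ j → x ∈ leaves (lookup ds i) → y ∈ leaves (lookup ds j) → node l ds ⊑ u
  separator-⊑ {u = u} {ds = ds} {i = i} {j} T! u⊑T v⊑T x∈u y∈u i≢j x∈i y∈j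
    with ⊑-nested T! u⊑T v⊑T x∈u (leaf-of-child (∈-lookup {xs = ds} i) x∈i)
  ... | inj₁ v⊑u              = v⊑u
  ... | inj₂ (below u⊑c c∈ds) = ⊥-elim (i≢j (begin
    i           ≡⟨ leaf-determines-index ds ds! x∈i (child-leaf x∈u) ⟩
    index c∈ds  ≡⟨ leaf-determines-index ds ds! (child-leaf y∈u) y∈j ⟩
    j           ∎))
    where
    ds! : Unique (leavesL ds)
    ds! = Unique-⊑ T! v⊑T
    child-leaf : ∀ {z} → z ∈ leaves u → z ∈ leaves (lookup ds (index c∈ds))
    child-leaf z∈u = leaf-of-lookup-index c∈ds (leaf-of-⊑ u⊑c z∈u)

  Fitch-below-l0 : ∀ {T : Tree n} {cs l ds} → IsFitch T → node l0 cs ⊑ T →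
    l ≢ l0 → ¬ node l ds ⊑ node l0 cs
  Fitch-below-l0 _      _   l≢l0 here             = l≢l0 refl
  Fitch-below-l0 Fitch u⊑T l≢l0 (there v⊑c c∈cs) =
    proj₁ (Fitch u⊑T (index c∈cs) (subst (_ ⊑_) (lookup-index c∈cs) v⊑c)) (refl , l≢l0)

  LeftSplitAt⇒SplitAt : ∀ {T : Tree n} {l x y} → LeftSplitAt T l x y → SplitAt T l x y
  LeftSplitAt⇒SplitAt (ds , v⊑T , i , j , i<j , x∈i , y∈j) =
    ds , v⊑T , i , j , (λ i≡j → <-irrefl (cong toℕ i≡j) i<j) , x∈i , y∈j

  Fitch-split-below-l0 : ∀ {T : Tree n} {cs l x y} → FitchCotree T → node l0 cs ⊑ T →
    x ∈ leaves (node l0 cs) → y ∈ leaves (node l0 cs) → l ≢ l0 → ¬ SplitAt T l x y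
  Fitch-split-below-l0 (cotree , Fitch) u⊑T x∈u y∈u l≢l0 (_ , v⊑T , _ , _ , i≢j , x∈i , y∈j) =
    Fitch-below-l0 Fitch u⊑T l≢l0
      (separator-⊑ (IsCotree.leafUniq cotree) u⊑T v⊑T x∈u y∈u i≢j x∈i y∈j)

lemma3 : ∀ {n} (E : PartialTuple (suc n)) → FitchSatisfiable E →
    (T : Tree (suc n)) → FitchCotree T → Discriminating T → Explains T E →
    ∀ {cs} → node l0 cs ⊑ T →
    (C : Pred (Fin (suc n)) 0ℓ) → (∀ x → C x → x ∈ leaves (node l0 cs)) →
    G₀Edgeless E C
lemma3 _ _ T fitchCotree _ (_ , explains₁ , explains→) u⊑T _ C⊆u x y x∈C y∈C = λ where
    (inj₁ x₁y) → no-split (λ ()) (explains₁ x₁y)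
    (inj₂ x→y) → no-split (λ ()) (LeftSplitAt⇒SplitAt (explains→ x→y))
  where
  no-split : ∀ {l} → l ≢ l0 → ¬ SplitAt T l x y
  no-split = Fitch-split-below-l0 fitchCotree u⊑T (C⊆u x x∈C) (C⊆u y y∈C)
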